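{- Let $R$ be a commutative ring with identity and $n\ge 2$. Let $wC_n$ be the weighted directed cycle with vertices $0,1,\dots,n-1$ (indices taken modulo $n$), arcs $(i,i+1)$ for $i=0,\dots,n-1$, and arc $(i,i+1)$ having weight $w_i\in R$. Let $W=(d_{ij})_{0\le i,j\le n-1}$ where $d_{ii}=0$ and for $i\ne j$, $d_{ij}=\sum_{k=0}^{m-1}w_{i+k}$ with $m\in\{1,\dots,n-1\}$, $m\equiv j-i\pmod n$. Let $w=\sum_{i=0}^{n-1}w_i$ and $w^{(2)}=\sum_{0\le i<j\le n-1}w_iw_j$, and suppose $w$ is invertible in $R$. Let $P$ be the $n\times n$ cyclic permutation matrix whose nonzero entries are $P_{i,i+1}=1$ ($i=0,\dots,n-1$, indices mod $n$), and set $$\lambda=\frac{w^{(2)}}{w},\quad \alpha=\frac1w[w_{n-1},w_0,\dots,w_{n-2}]^T,\quad \beta=\frac1w[w_0,w_1,\dots,w_{n-1}]^T,\quad L=\frac1w(I-P).$$ Then (1) $\alpha^T\mathbf{j}=1$, $L\mathbf{j}=\mathbf{0}$, $\alpha^TW=\lambda\mathbf{j}^T$ and $LW+I=\beta\mathbf{j}^T$; and (2) $\mathbf{j}^T\beta=1$, $\mathbf{j}^TL=\mathbf{0}$, $W\beta=\lambda\mathbf{j}$ and $WL+I=\mathbf{j}\alpha^T$.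
   Context: $\frac{1}{w}$ denotes the multiplicative inverse of $w$ in $R$. $\mathbf{j}$ is the $n\times1$ all-ones vector, $I$ the identity matrix, $\mathbf{0}$ a zero matrix/vector, $^T$ transpose. -}

module Defs where

open import Level using (_⊔_)
open import Data.Nat using (ℕ; zero; suc; _∸_) renaming (_+_ to _+ℕ_)
open import Data.Nat.DivMod using (_%_; m%n<n)
open import Data.Fin using (Fin; toℕ; fromℕ<; _≟_)
open import Relation.Nullary using (yes; no)
open import Algebra.Bundles using (CommutativeRing)
import Algebra.Definitions.RawMonoid as RM

module Cyc {c ℓ} (R : CommutativeRing c ℓ) where
  open CommutativeRing R

  Mat : ℕ → ℕ → Set c
  Mat m p = Fin m → Fin p → Carrier

  Σ : ∀ {p} → (Fin p → Carrier) → Carrier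
  Σ = RM.sum +-rawMonoid

  Σ< : ℕ → (ℕ → Carrier) → Carrier
  Σ< zero f = 0#
  Σ< (suc m) f = Σ< m f + f m

  mul : ∀ {m p q} → Mat m p → Mat p q → Mat m q
  mul A B i j = Σ (λ k → A i k * B k j)

  add : ∀ {m p} → Mat m p → Mat m p → Mat m p
  add A B i j = A i j + B i j

  scale : ∀ {m p} → Carrier → Mat m p → Mat m p
  scale a A i j = a * A i j

  transpose : ∀ {m p} → Mat m p → Mat p m
  transpose A i j = A j i

  _≋_ : ∀ {m p} → Mat m p → Mat m p → Set ℓ
  A ≋ B = ∀ i j → A i j ≈ B i j

  idM : ∀ {m} → Mat m m
  idM i j with i ≟ j
  ... | yes _ = 1#
  ... | no  _ = 0#

  zeroM : ∀ {m p} → Mat m p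
  zeroM _ _ = 0#

  ones : ∀ {m} → Mat m 1
  ones _ _ = 1#

  col : ∀ {m} → (Fin m → Carrier) → Mat m 1
  col v i _ = v i

  scalarM : Carrier → Mat 1 1
  scalarM a _ _ = a

  module Cycle (k : ℕ) (w : Fin (suc (suc k)) → Carrier) where
    n : ℕ
    n = suc (suc k)

    ix : ℕ → Fin n
    ix m = fromℕ< (m%n<n m n)

    wₘ : ℕ → Carrier
    wₘ m = w (ix m)

    -- distance matrix W = (d_ij): d_ii = 0, and for i ≠ j
    -- d_ij = Σ_{k=0}^{m-1} w_{i+k}, m ∈ {1..n-1}, m ≡ j - i (mod n)
    W : Mat n n
    W i j with i ≟ j
    ... | yes _ = 0#
    ... | no  _ = Σ< ((toℕ j +ℕ (n ∸ toℕ i)) % n) (λ t → wₘ (toℕ i +ℕ t))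

    wsum : Carrier
    wsum = Σ w

    w2 : Carrier
    w2 = Σ< n (λ j → Σ< j (λ i → wₘ i * wₘ j))

    P : Mat n n
    P i j with j ≟ ix (suc (toℕ i))
    ... | yes _ = 1#
    ... | no  _ = 0#

    module WithInverse (winv : Carrier) where
      λ' : Carrier
      λ' = w2 * winv

      -- α = (1/w)[w_{n-1}, w_0, ..., w_{n-2}]^T, i.e. α_i = w_{i-1}/w
      α : Mat n 1
      α = scale winv (col (λ i → wₘ (toℕ i +ℕ (n ∸ 1))))

      β : Mat n 1
      β = scale winv (col w)

      L : Mat n n
      L = scale winv (add idM (λ i j → - P i j))

-- The distance matrix satisfies two recurrences along the cycle,
--   d_ij + [i = j] w = w_i + d_{i+1,j}   and   d_ij + [i = j] w = d_{i,j-1} + w_{j-1},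
-- which are exactly LW + I = β jᵀ and WL + I = j αᵀ; the identities involving only j, α, β, L
-- are direct sums.  From the first recurrence, L (Wβ) = β (jᵀβ) − β = 0, so Wβ is constant along
-- the cycle, and its entry at vertex 0 is Σ_{i<j} w_i w_j / w = λ.  Finally
-- j (αᵀW) = (WL + I) W = W (LW + I) = Wβ jᵀ = λ j jᵀ, and left multiplication by j is injective
-- on row vectors.
module Submission where

open import Defs
open import Algebra.Bundles using (CommutativeRing)
open import Data.Empty using (⊥-elim)
open import Data.Fin using (Fin; toℕ; fromℕ; inject₁; _≟_; punchIn) renaming (zero to fz)
open import Data.Fin.Permutation using (permutation)
open import Data.Fin.Properties using (toℕ<n; toℕ-fromℕ<; toℕ-injective; toℕ-inject₁; toℕ-fromℕ; punchInᵢ≢i)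
open import Data.Nat using (ℕ; zero; suc; _∸_; _<_; z≤n; s≤s) renaming (_+_ to _+ℕ_)
open import Data.Nat.DivMod using (_%_; m%n<n; m%n%n≡m%n; [m+n]%n≡m%n; %-distribˡ-+; m<n⇒m%n≡m)
open import Data.Nat.Properties as ℕ using ()
open import Data.Product using (_×_; _,_)
open import Data.Vec.Functional using (replicate)
open import Relation.Binary.Bundles using (Setoid)
open import Relation.Binary.PropositionalEquality as ≡ using (_≡_; _≢_)
open import Relation.Nullary using (yes; no)

module SumProperties {c ℓ} (R : CommutativeRing c ℓ) where
  open CommutativeRing R
  open Cyc R
  open import Algebra.Properties.Ring ring using (-1*x≈-x)
  open import Algebra.Properties.Semiring.Sum semiring
    using (sum-cong-≋; sum-cong-≗; sum-remove; sum-replicate-zero; sum-init-last; *-distribˡ-sum)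
  open import Relation.Binary.Reasoning.Setoid setoid

  Σ-pick : ∀ {p} (a : Fin p) (f : Fin p → Carrier) → (∀ r → r ≢ a → f r ≈ 0#) → Σ f ≈ f a
  Σ-pick {suc p} a f f≈0 = begin
    Σ f                                     ≈⟨ sum-remove {i = a} f ⟩
    f a + Σ (λ r → f (punchIn a r))         ≈⟨ +-congˡ (sum-cong-≋ (λ r → f≈0 _ (punchInᵢ≢i a r))) ⟩
    f a + Σ (replicate p 0#)                ≈⟨ +-congˡ (sum-replicate-zero p) ⟩
    f a + 0#                                ≈⟨ +-identityʳ (f a) ⟩
    f a                                     ∎

  Σ-neg : ∀ {p} (f : Fin p → Carrier) → Σ (λ r → - f r) ≈ - Σ f
  Σ-neg f = begin
    Σ (λ r → - f r)      ≈⟨ sum-cong-≋ (λ r → sym (-1*x≈-x (f r))) ⟩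
    Σ (λ r → - 1# * f r) ≈⟨ sym (*-distribˡ-sum (- 1#) f) ⟩
    - 1# * Σ f           ≈⟨ -1*x≈-x (Σ f) ⟩
    - Σ f                ∎

  Σ<-cong : ∀ m {f g : ℕ → Carrier} → (∀ t → f t ≈ g t) → Σ< m f ≈ Σ< m g
  Σ<-cong zero    f≈g = refl
  Σ<-cong (suc m) f≈g = +-cong (Σ<-cong m f≈g) (f≈g m)

  Σ<-*ʳ : ∀ m (f : ℕ → Carrier) x → Σ< m f * x ≈ Σ< m (λ t → f t * x)
  Σ<-*ʳ zero    f x = zeroˡ x
  Σ<-*ʳ (suc m) f x = trans (distribʳ x (Σ< m f) (f m)) (+-congʳ (Σ<-*ʳ m f x))

  Σ≈Σ< : ∀ p (f : ℕ → Carrier) → Σ {p} (λ i → f (toℕ i)) ≈ Σ< p f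
  Σ≈Σ< zero    f = refl
  Σ≈Σ< (suc p) f = begin
    Σ {suc p} (λ i → f (toℕ i))                            ≈⟨ sum-init-last (λ i → f (toℕ i)) ⟩
    Σ {p} (λ i → f (toℕ (inject₁ i))) + f (toℕ (fromℕ p))  ≡⟨ ≡.cong₂ _+_ (sum-cong-≗ {p} (λ i → ≡.cong f (toℕ-inject₁ i))) (≡.cong f (toℕ-fromℕ p)) ⟩
    Σ {p} (λ i → f (toℕ i)) + f p                          ≈⟨ +-congʳ (Σ≈Σ< p f) ⟩
    Σ< p f + f p                                           ∎

module MatrixProperties {c ℓ} (R : CommutativeRing c ℓ) where
  open CommutativeRing R
  open Cyc R
  open SumProperties R using (Σ-pick; Σ-neg)
  open import Algebra.Properties.Ring ring using (-‿distribˡ-*; -‿distribʳ-*)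
  open import Algebra.Properties.CommutativeSemigroup *-commutativeSemigroup using (x∙yz≈y∙xz)
  open import Algebra.Properties.Semiring.Sum semiring
    using (sum-cong-≋; ∑-distrib-+; ∑-comm; *-distribˡ-sum; *-distribʳ-sum)
  open import Relation.Binary.Reasoning.Setoid setoid

  ≋-refl : ∀ {m p} {A : Mat m p} → A ≋ A
  ≋-refl _ _ = refl

  ≋-sym : ∀ {m p} {A B : Mat m p} → A ≋ B → B ≋ A
  ≋-sym A≋B i j = sym (A≋B i j)

  ≋-trans : ∀ {m p} {A B C : Mat m p} → A ≋ B → B ≋ C → A ≋ C
  ≋-trans A≋B B≋C i j = trans (A≋B i j) (B≋C i j)

  ≋-setoid : ℕ → ℕ → Setoid c ℓ
  ≋-setoid m p = record
    { Carrier       = Mat m p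
    ; _≈_           = _≋_
    ; isEquivalence = record { refl = ≋-refl ; sym = ≋-sym ; trans = ≋-trans }
    }

  neg : ∀ {m p} → Mat m p → Mat m p
  neg A i j = - A i j

  idM-diag : ∀ {m} (i : Fin m) → idM i i ≈ 1#
  idM-diag i with i ≟ i
  ... | yes _  = refl
  ... | no i≢i = ⊥-elim (i≢i ≡.refl)

  idM-off : ∀ {m} {i j : Fin m} → i ≢ j → idM i j ≈ 0#
  idM-off {i = i} {j} i≢j with i ≟ j
  ... | yes i≡j = ⊥-elim (i≢j i≡j)
  ... | no _    = refl

  mul-congˡ : ∀ {m p q} {A A′ : Mat m p} (B : Mat p q) → A ≋ A′ → mul A B ≋ mul A′ B
  mul-congˡ B A≋A′ i j = sum-cong-≋ (λ r → *-congʳ (A≋A′ i r))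

  mul-congʳ : ∀ {m p q} (A : Mat m p) {B B′ : Mat p q} → B ≋ B′ → mul A B ≋ mul A B′
  mul-congʳ A B≋B′ i j = sum-cong-≋ (λ r → *-congˡ (B≋B′ r j))

  add-cong : ∀ {m p} {A A′ B B′ : Mat m p} → A ≋ A′ → B ≋ B′ → add A B ≋ add A′ B′
  add-cong A≋A′ B≋B′ i j = +-cong (A≋A′ i j) (B≋B′ i j)

  mul-assoc : ∀ {m p q s} (A : Mat m p) (B : Mat p q) (C : Mat q s) → mul (mul A B) C ≋ mul A (mul B C)
  mul-assoc A B C i j = begin
    Σ (λ t → Σ (λ r → A i r * B r t) * C t j)   ≈⟨ sum-cong-≋ (λ t → *-distribʳ-sum (C t j) (λ r → A i r * B r t)) ⟩
    Σ (λ t → Σ (λ r → (A i r * B r t) * C t j)) ≈⟨ ∑-comm (λ t r → (A i r * B r t) * C t j) ⟩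
    Σ (λ r → Σ (λ t → (A i r * B r t) * C t j)) ≈⟨ sum-cong-≋ (λ r → sum-cong-≋ (λ t → *-assoc (A i r) (B r t) (C t j))) ⟩
    Σ (λ r → Σ (λ t → A i r * (B r t * C t j))) ≈⟨ sum-cong-≋ (λ r → sym (*-distribˡ-sum (A i r) (λ t → B r t * C t j))) ⟩
    Σ (λ r → A i r * Σ (λ t → B r t * C t j))   ∎

  mul-distribˡ-add : ∀ {m p q} (A : Mat m p) (B C : Mat p q) → mul A (add B C) ≋ add (mul A B) (mul A C)
  mul-distribˡ-add A B C i j =
    trans (sum-cong-≋ (λ r → distribˡ (A i r) (B r j) (C r j)))
          (∑-distrib-+ (λ r → A i r * B r j) (λ r → A i r * C r j))

  mul-distribʳ-add : ∀ {m p q} (A B : Mat m p) (C : Mat p q) → mul (add A B) C ≋ add (mul A C) (mul B C)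
  mul-distribʳ-add A B C i j =
    trans (sum-cong-≋ (λ r → distribʳ (C r j) (A i r) (B i r)))
          (∑-distrib-+ (λ r → A i r * C r j) (λ r → B i r * C r j))

  mul-identityˡ : ∀ {m p} (A : Mat m p) → mul idM A ≋ A
  mul-identityˡ A i j = begin
    Σ (λ r → idM i r * A r j) ≈⟨ Σ-pick i _ (λ r r≢i → trans (*-congʳ (idM-off (λ i≡r → r≢i (≡.sym i≡r)))) (zeroˡ _)) ⟩
    idM i i * A i j           ≈⟨ trans (*-congʳ (idM-diag i)) (*-identityˡ _) ⟩
    A i j                     ∎

  mul-identityʳ : ∀ {m p} (A : Mat m p) → mul A idM ≋ A
  mul-identityʳ A i j = begin
    Σ (λ r → A i r * idM r j) ≈⟨ Σ-pick j _ (λ r r≢j → trans (*-congˡ (idM-off r≢j)) (zeroʳ _)) ⟩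
    A i j * idM j j           ≈⟨ trans (*-congˡ (idM-diag j)) (*-identityʳ _) ⟩
    A i j                     ∎

  mul-scaleˡ : ∀ {m p q} a (A : Mat m p) (B : Mat p q) → mul (scale a A) B ≋ scale a (mul A B)
  mul-scaleˡ a A B i j =
    trans (sum-cong-≋ (λ r → *-assoc a (A i r) (B r j))) (sym (*-distribˡ-sum a (λ r → A i r * B r j)))

  mul-scaleʳ : ∀ {m p q} a (A : Mat m p) (B : Mat p q) → mul A (scale a B) ≋ scale a (mul A B)
  mul-scaleʳ a A B i j = begin
    Σ (λ r → A i r * (a * B r j)) ≈⟨ sum-cong-≋ (λ r → x∙yz≈y∙xz (A i r) a (B r j)) ⟩
    Σ (λ r → a * (A i r * B r j)) ≈⟨ sym (*-distribˡ-sum a (λ r → A i r * B r j)) ⟩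
    a * mul A B i j               ∎

  mul-negˡ : ∀ {m p q} (A : Mat m p) (B : Mat p q) → mul (neg A) B ≋ neg (mul A B)
  mul-negˡ A B i j = trans (sum-cong-≋ (λ r → sym (-‿distribˡ-* (A i r) (B r j)))) (Σ-neg (λ r → A i r * B r j))

  mul-negʳ : ∀ {m p q} (A : Mat m p) (B : Mat p q) → mul A (neg B) ≋ neg (mul A B)
  mul-negʳ A B i j = trans (sum-cong-≋ (λ r → sym (-‿distribʳ-* (A i r) (B r j)))) (Σ-neg (λ r → A i r * B r j))

  scalarM-1#≋idM : scalarM 1# ≋ idM
  scalarM-1#≋idM fz fz = refl

  ones-mul-injective : ∀ {m p} {A B : Mat 1 p} → mul (ones {suc m}) A ≋ mul ones B → A ≋ B
  ones-mul-injective {A = A} {B} jA≋jB fz j = begin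
    A fz j               ≈⟨ sym (trans (+-identityʳ _) (*-identityˡ _)) ⟩
    1# * A fz j + 0#     ≈⟨ jA≋jB fz j ⟩
    1# * B fz j + 0#     ≈⟨ trans (+-identityʳ _) (*-identityˡ _) ⟩
    B fz j               ∎

module CycleIndex {c ℓ} (R : CommutativeRing c ℓ) (k : ℕ) (w : Fin (suc (suc k)) → CommutativeRing.Carrier R) where
  open Cyc R
  open Cycle k w
  open import Algebra.Properties.CommutativeSemigroup ℕ.+-commutativeSemigroup using (xy∙z≈y∙xz)
  open ≡.≡-Reasoning

  -- Since n ∸ 1 reduces to suc k, α is definitionally the column (winv * w (prv i))ᵢ.
  nxt prv : Fin n → Fin n
  nxt i = ix (suc (toℕ i))
  prv i = ix (toℕ i +ℕ suc k)

  [m%n+k]%n≡[m+k]%n : ∀ a b → (a % n +ℕ b) % n ≡ (a +ℕ b) % n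
  [m%n+k]%n≡[m+k]%n a b = begin
    (a % n +ℕ b) % n            ≡⟨ %-distribˡ-+ (a % n) b n ⟩
    (a % n % n +ℕ b % n) % n    ≡⟨ ≡.cong (λ x → (x +ℕ b % n) % n) (m%n%n≡m%n a n) ⟩
    (a % n +ℕ b % n) % n        ≡⟨ ≡.sym (%-distribˡ-+ a b n) ⟩
    (a +ℕ b) % n                ∎

  toℕ-ix : ∀ a → toℕ (ix a) ≡ a % n
  toℕ-ix a = toℕ-fromℕ< (m%n<n a n)

  ix-cong-% : ∀ a b → a % n ≡ b % n → ix a ≡ ix b
  ix-cong-% a b e = toℕ-injective (≡.trans (toℕ-ix a) (≡.trans e (≡.sym (toℕ-ix b))))

  ix-toℕ : ∀ i → ix (toℕ i) ≡ i
  ix-toℕ i = toℕ-injective (≡.trans (toℕ-ix (toℕ i)) (m<n⇒m%n≡m (toℕ<n i)))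

  ix-+ : ∀ a b → ix (toℕ (ix a) +ℕ b) ≡ ix (a +ℕ b)
  ix-+ a b = ix-cong-% (toℕ (ix a) +ℕ b) (a +ℕ b) (≡.trans (≡.cong (λ x → (x +ℕ b) % n) (toℕ-ix a)) ([m%n+k]%n≡[m+k]%n a b))

  ix-+n : ∀ a → ix (a +ℕ n) ≡ ix a
  ix-+n a = ix-cong-% (a +ℕ n) a ([m+n]%n≡m%n a n)

  ix-+-cong : ∀ a b t → ix a ≡ ix b → ix (a +ℕ t) ≡ ix (b +ℕ t)
  ix-+-cong a b t e = ≡.trans (≡.sym (ix-+ a t)) (≡.trans (≡.cong (λ x → ix (toℕ x +ℕ t)) e) (ix-+ b t))

  ix-suc+n : ∀ a → ix (suc (a +ℕ suc k)) ≡ ix a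
  ix-suc+n a = ≡.trans (≡.cong ix (≡.sym (ℕ.+-suc a (suc k)))) (ix-+n a)

  prv-nxt : ∀ i → prv (nxt i) ≡ i
  prv-nxt i = ≡.trans (ix-+ (suc (toℕ i)) (suc k)) (≡.trans (ix-suc+n (toℕ i)) (ix-toℕ i))

  ix-suc : ∀ a → ix (suc (toℕ (ix a))) ≡ ix (suc a)
  ix-suc a = begin
    ix (suc (toℕ (ix a)))   ≡⟨ ≡.cong ix (ℕ.+-comm 1 (toℕ (ix a))) ⟩
    ix (toℕ (ix a) +ℕ 1)    ≡⟨ ix-+ a 1 ⟩
    ix (a +ℕ 1)             ≡⟨ ≡.cong ix (ℕ.+-comm a 1) ⟩
    ix (suc a)              ∎

  nxt-prv : ∀ j → nxt (prv j) ≡ j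
  nxt-prv j = ≡.trans (ix-suc (toℕ j +ℕ suc k)) (≡.trans (ix-suc+n (toℕ j)) (ix-toℕ j))

  -- Literally the number of arcs in the definition of W.
  dist : Fin n → Fin n → ℕ
  dist i j = (toℕ j +ℕ (n ∸ toℕ i)) % n

  dist<n : ∀ i j → dist i j < n
  dist<n i j = m%n<n (toℕ j +ℕ (n ∸ toℕ i)) n

  ix-dist : ∀ i j → ix (toℕ i +ℕ dist i j) ≡ j
  ix-dist i j = ≡.trans (ix-cong-% (toℕ i +ℕ dist i j) (toℕ j) i+dist≡j) (ix-toℕ j)
    where
    i+dist≡j : (toℕ i +ℕ dist i j) % n ≡ toℕ j % n
    i+dist≡j = begin
      (toℕ i +ℕ (toℕ j +ℕ (n ∸ toℕ i)) % n) % n  ≡⟨ ≡.cong (_% n) (ℕ.+-comm (toℕ i) _) ⟩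
      ((toℕ j +ℕ (n ∸ toℕ i)) % n +ℕ toℕ i) % n  ≡⟨ [m%n+k]%n≡[m+k]%n (toℕ j +ℕ (n ∸ toℕ i)) (toℕ i) ⟩
      (toℕ j +ℕ (n ∸ toℕ i) +ℕ toℕ i) % n        ≡⟨ ≡.cong (_% n) (ℕ.+-assoc (toℕ j) (n ∸ toℕ i) (toℕ i)) ⟩
      (toℕ j +ℕ ((n ∸ toℕ i) +ℕ toℕ i)) % n      ≡⟨ ≡.cong (λ x → (toℕ j +ℕ x) % n) (ℕ.m∸n+n≡m (ℕ.<⇒≤ (toℕ<n i))) ⟩
      (toℕ j +ℕ n) % n                           ≡⟨ [m+n]%n≡m%n (toℕ j) n ⟩
      toℕ j % n                                  ∎

  dist-unique : ∀ i {j m} → m < n → ix (toℕ i +ℕ m) ≡ j → dist i j ≡ m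
  dist-unique i {j} {m} m<n i+m≡j = begin
    (toℕ j +ℕ (n ∸ toℕ i)) % n                   ≡⟨ ≡.cong (λ x → (toℕ x +ℕ (n ∸ toℕ i)) % n) (≡.sym i+m≡j) ⟩
    (toℕ (ix (toℕ i +ℕ m)) +ℕ (n ∸ toℕ i)) % n   ≡⟨ ≡.cong (λ x → (x +ℕ (n ∸ toℕ i)) % n) (toℕ-ix (toℕ i +ℕ m)) ⟩
    ((toℕ i +ℕ m) % n +ℕ (n ∸ toℕ i)) % n        ≡⟨ [m%n+k]%n≡[m+k]%n (toℕ i +ℕ m) (n ∸ toℕ i) ⟩
    (toℕ i +ℕ m +ℕ (n ∸ toℕ i)) % n              ≡⟨ ≡.cong (_% n) (xy∙z≈y∙xz (toℕ i) m (n ∸ toℕ i)) ⟩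
    (m +ℕ (toℕ i +ℕ (n ∸ toℕ i))) % n            ≡⟨ ≡.cong (λ x → (m +ℕ x) % n) (ℕ.m+[n∸m]≡n (ℕ.<⇒≤ (toℕ<n i))) ⟩
    (m +ℕ n) % n                                 ≡⟨ [m+n]%n≡m%n m n ⟩
    m % n                                        ≡⟨ m<n⇒m%n≡m m<n ⟩
    m                                            ∎

  ix-+0 : ∀ i {j} → ix (toℕ i +ℕ 0) ≡ j → i ≡ j
  ix-+0 i i+0≡j = ≡.trans (≡.sym (ix-toℕ i)) (≡.trans (≡.cong ix (≡.sym (ℕ.+-identityʳ (toℕ i)))) i+0≡j)

  dist-self : ∀ i → dist i i ≡ 0
  dist-self i = dist-unique i (s≤s z≤n) (≡.trans (≡.cong ix (ℕ.+-identityʳ (toℕ i))) (ix-toℕ i))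

  dist-nxt-self : ∀ i → dist (nxt i) i ≡ suc k
  dist-nxt-self i = dist-unique (nxt i) (ℕ.n<1+n (suc k)) (prv-nxt i)

  dist-self-prv : ∀ i → dist i (prv i) ≡ suc k
  dist-self-prv i = dist-unique i (ℕ.n<1+n (suc k)) ≡.refl

  dist-suc-nxt : ∀ {i j} → i ≢ j → dist i j ≡ suc (dist (nxt i) j)
  dist-suc-nxt {i} {j} i≢j with dist i j | dist<n i j | ix-dist i j
  ... | zero  | _   | i+0≡j = ⊥-elim (i≢j (ix-+0 i i+0≡j))
  ... | suc m | m<n | i+m≡j = ≡.cong suc (≡.sym (dist-unique (nxt i) (ℕ.<⇒≤ m<n) (begin
    ix (toℕ (ix (suc (toℕ i))) +ℕ m)  ≡⟨ ix-+ (suc (toℕ i)) m ⟩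
    ix (suc (toℕ i +ℕ m))             ≡⟨ ≡.cong ix (≡.sym (ℕ.+-suc (toℕ i) m)) ⟩
    ix (toℕ i +ℕ suc m)               ≡⟨ i+m≡j ⟩
    j                                 ∎)))

  dist-suc-prv : ∀ {i j} → i ≢ j → dist i j ≡ suc (dist i (prv j))
  dist-suc-prv {i} {j} i≢j with dist i j | dist<n i j | ix-dist i j
  ... | zero  | _   | i+0≡j = ⊥-elim (i≢j (ix-+0 i i+0≡j))
  ... | suc m | m<n | i+m≡j = ≡.cong suc (≡.sym (dist-unique i (ℕ.<⇒≤ m<n) (begin
    ix (toℕ i +ℕ m)                         ≡⟨ ≡.sym (ix-suc+n (toℕ i +ℕ m)) ⟩
    ix (suc (toℕ i +ℕ m) +ℕ suc k)          ≡⟨ ≡.cong (λ x → ix (x +ℕ suc k)) (≡.sym (ℕ.+-suc (toℕ i) m)) ⟩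
    ix (toℕ i +ℕ suc m +ℕ suc k)            ≡⟨ ≡.sym (ix-+ (toℕ i +ℕ suc m) (suc k)) ⟩
    prv (ix (toℕ i +ℕ suc m))               ≡⟨ ≡.cong prv i+m≡j ⟩
    prv j                                   ∎)))

module WeightedCycle {c ℓ} (R : CommutativeRing c ℓ) (k : ℕ) (w : Fin (suc (suc k)) → CommutativeRing.Carrier R) where
  open CommutativeRing R
  open Cyc R
  open Cycle k w
  open CycleIndex R k w
  open SumProperties R
  open MatrixProperties R
  open import Algebra.Properties.Semiring.Sum semiring using (sum-cong-≋; sum-cong-≗)
  open import Algebra.Properties.Ring ring using (+-cancelˡ)
  open import Relation.Binary.Reasoning.Setoid setoid

  walkWeight : ℕ → ℕ → Carrier
  walkWeight a m = Σ< m (λ t → wₘ (a +ℕ t))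

  walkWeight-sucˡ : ∀ a m → walkWeight a (suc m) ≈ wₘ a + walkWeight (suc a) m
  walkWeight-sucˡ a zero = begin
    0# + wₘ (a +ℕ 0) ≡⟨ ≡.cong (λ x → 0# + wₘ x) (ℕ.+-identityʳ a) ⟩
    0# + wₘ a        ≈⟨ +-comm 0# (wₘ a) ⟩
    wₘ a + 0#        ∎
  walkWeight-sucˡ a (suc m) = begin
    walkWeight a (suc m) + wₘ (a +ℕ suc m)           ≈⟨ +-congʳ (walkWeight-sucˡ a m) ⟩
    wₘ a + walkWeight (suc a) m + wₘ (a +ℕ suc m)    ≡⟨ ≡.cong (λ x → wₘ a + walkWeight (suc a) m + wₘ x) (ℕ.+-suc a m) ⟩
    wₘ a + walkWeight (suc a) m + wₘ (suc a +ℕ m)    ≈⟨ +-assoc (wₘ a) _ _ ⟩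
    wₘ a + walkWeight (suc a) (suc m)                ∎

  walkWeight-cong : ∀ a b m → ix a ≡ ix b → walkWeight a m ≈ walkWeight b m
  walkWeight-cong a b m a≡b = Σ<-cong m (λ t → reflexive (≡.cong w (ix-+-cong a b t a≡b)))

  walkWeight-cycle : ∀ a → walkWeight a n ≈ wsum
  walkWeight-cycle zero = begin
    Σ< n wₘ                    ≈⟨ sym (Σ≈Σ< n wₘ) ⟩
    Σ {n} (λ i → wₘ (toℕ i))   ≡⟨ sum-cong-≗ {n} {λ i → wₘ (toℕ i)} {w} (λ i → ≡.cong w (ix-toℕ i)) ⟩
    wsum                       ∎
  walkWeight-cycle (suc a) = trans (+-cancelˡ (wₘ a) _ _ shifted) (walkWeight-cycle a)
    where
    shifted : wₘ a + walkWeight (suc a) n ≈ wₘ a + walkWeight a n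
    shifted = begin
      wₘ a + walkWeight (suc a) n        ≈⟨ sym (walkWeight-sucˡ a n) ⟩
      walkWeight a n + wₘ (a +ℕ n)       ≡⟨ ≡.cong (λ x → walkWeight a n + w x) (ix-+n a) ⟩
      walkWeight a n + wₘ a              ≈⟨ +-comm _ (wₘ a) ⟩
      wₘ a + walkWeight a n              ∎

  W-walk : ∀ i j → W i j ≈ walkWeight (toℕ i) (dist i j)
  W-walk i j with i ≟ j
  ... | yes ≡.refl = reflexive (≡.cong (walkWeight (toℕ i)) (≡.sym (dist-self i)))
  ... | no _       = refl

  walkWeight-nxt : ∀ i m → walkWeight (suc (toℕ i)) m ≈ walkWeight (toℕ (nxt i)) m
  walkWeight-nxt i m = walkWeight-cong (suc (toℕ i)) (toℕ (nxt i)) m (≡.sym (ix-toℕ (nxt i)))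

  wₘ-toℕ : ∀ i → wₘ (toℕ i) ≡ w i
  wₘ-toℕ i = ≡.cong w (ix-toℕ i)

  W-row : ∀ i j → W i j + idM i j * wsum ≈ w i + W (nxt i) j
  W-row i j with i ≟ j
  ... | yes ≡.refl = begin
    0# + 1# * wsum                                   ≈⟨ trans (+-identityˡ _) (*-identityˡ wsum) ⟩
    wsum                                             ≈⟨ sym (walkWeight-cycle (toℕ i)) ⟩
    walkWeight (toℕ i) n                             ≈⟨ walkWeight-sucˡ (toℕ i) (suc k) ⟩
    wₘ (toℕ i) + walkWeight (suc (toℕ i)) (suc k)    ≈⟨ +-cong (reflexive (wₘ-toℕ i)) (walkWeight-nxt i (suc k)) ⟩
    w i + walkWeight (toℕ (nxt i)) (suc k)           ≡⟨ ≡.cong (λ m → w i + walkWeight (toℕ (nxt i)) m) (≡.sym (dist-nxt-self i)) ⟩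
    w i + walkWeight (toℕ (nxt i)) (dist (nxt i) i)  ≈⟨ +-congˡ (sym (W-walk (nxt i) i)) ⟩
    w i + W (nxt i) i                                ∎
  ... | no i≢j = begin
    walkWeight (toℕ i) (dist i j) + 0# * wsum          ≈⟨ trans (+-congˡ (zeroˡ wsum)) (+-identityʳ _) ⟩
    walkWeight (toℕ i) (dist i j)                      ≡⟨ ≡.cong (walkWeight (toℕ i)) (dist-suc-nxt i≢j) ⟩
    walkWeight (toℕ i) (suc (dist (nxt i) j))          ≈⟨ walkWeight-sucˡ (toℕ i) (dist (nxt i) j) ⟩
    wₘ (toℕ i) + walkWeight (suc (toℕ i)) (dist (nxt i) j) ≈⟨ +-cong (reflexive (wₘ-toℕ i)) (walkWeight-nxt i (dist (nxt i) j)) ⟩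
    w i + walkWeight (toℕ (nxt i)) (dist (nxt i) j)    ≈⟨ +-congˡ (sym (W-walk (nxt i) j)) ⟩
    w i + W (nxt i) j                                  ∎

  W-col : ∀ i j → W i j + idM i j * wsum ≈ W i (prv j) + w (prv j)
  W-col i j with i ≟ j
  ... | yes ≡.refl = begin
    0# + 1# * wsum                                          ≈⟨ trans (+-identityˡ _) (*-identityˡ wsum) ⟩
    wsum                                                    ≈⟨ sym (walkWeight-cycle (toℕ i)) ⟩
    walkWeight (toℕ i) (suc k) + w (prv i)                  ≡⟨ ≡.cong (λ m → walkWeight (toℕ i) m + w (prv i)) (≡.sym (dist-self-prv i)) ⟩
    walkWeight (toℕ i) (dist i (prv i)) + w (prv i)         ≈⟨ +-congʳ (sym (W-walk i (prv i))) ⟩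
    W i (prv i) + w (prv i)                                 ∎
  ... | no i≢j = begin
    walkWeight (toℕ i) (dist i j) + 0# * wsum               ≈⟨ trans (+-congˡ (zeroˡ wsum)) (+-identityʳ _) ⟩
    walkWeight (toℕ i) (dist i j)                           ≡⟨ ≡.cong (walkWeight (toℕ i)) (dist-suc-prv i≢j) ⟩
    walkWeight (toℕ i) (dist i (prv j)) + wₘ (toℕ i +ℕ dist i (prv j)) ≡⟨ ≡.cong (λ v → walkWeight (toℕ i) (dist i (prv j)) + w v) (ix-dist i (prv j)) ⟩
    walkWeight (toℕ i) (dist i (prv j)) + w (prv j)         ≈⟨ +-congʳ (sym (W-walk i (prv j))) ⟩
    W i (prv j) + w (prv j)                                 ∎

  W₀≈walkWeight : ∀ j → W fz j ≈ walkWeight 0 (toℕ j)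
  W₀≈walkWeight j = trans (W-walk fz j) (reflexive (≡.cong (walkWeight 0) (dist-unique fz (toℕ<n j) (ix-toℕ j))))

  Σ-W₀*w≈w2 : Σ (λ r → W fz r * w r) ≈ w2
  Σ-W₀*w≈w2 = begin
    Σ {n} (λ r → W fz r * w r)                     ≈⟨ sum-cong-≋ (λ r → *-cong (W₀≈walkWeight r) (reflexive (≡.sym (wₘ-toℕ r)))) ⟩
    Σ {n} (λ r → walkWeight 0 (toℕ r) * wₘ (toℕ r)) ≈⟨ Σ≈Σ< n (λ t → walkWeight 0 t * wₘ t) ⟩
    Σ< n (λ t → walkWeight 0 t * wₘ t)             ≈⟨ Σ<-cong n (λ t → Σ<-*ʳ t wₘ (wₘ t)) ⟩
    w2                                             ∎

  P-nxt : ∀ i → P i (nxt i) ≈ 1#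
  P-nxt i with nxt i ≟ nxt i
  ... | yes _    = refl
  ... | no i′≢i′ = ⊥-elim (i′≢i′ ≡.refl)

  P-off : ∀ {i j} → j ≢ nxt i → P i j ≈ 0#
  P-off {i} {j} j≢i′ with j ≟ nxt i
  ... | yes j≡i′ = ⊥-elim (j≢i′ j≡i′)
  ... | no _     = refl

  mul-Pˡ : ∀ {q} (X : Mat n q) i j → mul P X i j ≈ X (nxt i) j
  mul-Pˡ X i j = begin
    Σ (λ r → P i r * X r j)    ≈⟨ Σ-pick (nxt i) (λ r → P i r * X r j) (λ r r≢i′ → trans (*-congʳ (P-off r≢i′)) (zeroˡ _)) ⟩
    P i (nxt i) * X (nxt i) j  ≈⟨ trans (*-congʳ (P-nxt i)) (*-identityˡ _) ⟩
    X (nxt i) j                ∎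

  mul-Pʳ : ∀ {m} (X : Mat m n) i j → mul X P i j ≈ X i (prv j)
  mul-Pʳ X i j = begin
    Σ (λ r → X i r * P r j)    ≈⟨ Σ-pick (prv j) (λ r → X i r * P r j) (λ r r≢j′ → trans (*-congˡ (P-off (j≢nxt r≢j′))) (zeroʳ _)) ⟩
    X i (prv j) * P (prv j) j  ≈⟨ trans (*-congˡ P-prv) (*-identityʳ _) ⟩
    X i (prv j)                ∎
    where
    j≢nxt : ∀ {r} → r ≢ prv j → j ≢ nxt r
    j≢nxt {r} r≢j′ j≡r′ = r≢j′ (≡.trans (≡.sym (prv-nxt r)) (≡.cong prv (≡.sym j≡r′)))
    P-prv : P (prv j) j ≈ 1#
    P-prv = ≡.subst (λ v → P (prv j) v ≈ 1#) (nxt-prv j) (P-nxt (prv j))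

  module Normalised (winv : Carrier) (winv*w≈1 : winv * wsum ≈ 1#) where
    open WithInverse winv
    open import Algebra.Properties.Ring ring using (xyx⁻¹≈y; x∙y⁻¹≈ε⇒x≈y)
    open import Algebra.Properties.CommutativeSemigroup +-commutativeSemigroup using (xy∙z≈xz∙y)
    open import Algebra.Properties.CommutativeSemigroup *-commutativeSemigroup using (x∙yz≈y∙xz; xy∙z≈y∙xz)
    open import Algebra.Properties.Semiring.Sum semiring using (*-distribˡ-sum; ∑-permute)

    winv*x≈0⇒x≈0 : ∀ {x} → winv * x ≈ 0# → x ≈ 0#
    winv*x≈0⇒x≈0 {x} winv*x≈0 = begin
      x                    ≈⟨ sym (*-identityˡ x) ⟩
      1# * x               ≈⟨ *-congʳ (sym winv*w≈1) ⟩
      winv * wsum * x      ≈⟨ xy∙z≈y∙xz winv wsum x ⟩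
      wsum * (winv * x)    ≈⟨ *-congˡ winv*x≈0 ⟩
      wsum * 0#            ≈⟨ zeroʳ wsum ⟩
      0#                   ∎

    winv[x-y]+d≈winv*z : ∀ {x d y z} → x + d * wsum ≈ y + z → winv * (x - y) + d ≈ winv * z
    winv[x-y]+d≈winv*z {x} {d} {y} {z} x+dw≈y+z = begin
      winv * (x - y) + d                    ≈⟨ +-congˡ d≈winv[dw] ⟩
      winv * (x - y) + winv * (d * wsum)    ≈⟨ sym (distribˡ winv (x - y) (d * wsum)) ⟩
      winv * (x - y + d * wsum)             ≈⟨ *-congˡ (xy∙z≈xz∙y x (- y) (d * wsum)) ⟩
      winv * (x + d * wsum - y)             ≈⟨ *-congˡ (+-congʳ x+dw≈y+z) ⟩
      winv * (y + z - y)                    ≈⟨ *-congˡ (xyx⁻¹≈y y z) ⟩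
      winv * z                              ∎
      where
      d≈winv[dw] : d ≈ winv * (d * wsum)
      d≈winv[dw] = trans (sym (*-identityʳ d)) (trans (*-congˡ (sym winv*w≈1)) (x∙yz≈y∙xz d winv wsum))

    Σ[winv*f]≈1 : ∀ (f : Fin n → Carrier) → Σ f ≈ wsum → Σ (λ r → winv * f r) ≈ 1#
    Σ[winv*f]≈1 f Σf≈w = trans (sym (*-distribˡ-sum winv f)) (trans (*-congˡ Σf≈w) winv*w≈1)

    Σ-w∘prv : Σ (λ r → w (prv r)) ≈ wsum
    Σ-w∘prv = sym (∑-permute w (permutation prv nxt prv-nxt nxt-prv))

    mul-Lˡ : ∀ {q} (X : Mat n q) i j → mul L X i j ≈ winv * (X i j - X (nxt i) j)
    mul-Lˡ X i j = begin
      mul L X i j                                  ≈⟨ mul-scaleˡ winv (add idM (neg P)) X i j ⟩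
      winv * mul (add idM (neg P)) X i j           ≈⟨ *-congˡ (mul-distribʳ-add idM (neg P) X i j) ⟩
      winv * (mul idM X i j + mul (neg P) X i j)   ≈⟨ *-congˡ (+-cong (mul-identityˡ X i j) (trans (mul-negˡ P X i j) (-‿cong (mul-Pˡ X i j)))) ⟩
      winv * (X i j - X (nxt i) j)                 ∎

    mul-Lʳ : ∀ {m} (X : Mat m n) i j → mul X L i j ≈ winv * (X i j - X i (prv j))
    mul-Lʳ X i j = begin
      mul X L i j                                  ≈⟨ mul-scaleʳ winv X (add idM (neg P)) i j ⟩
      winv * mul X (add idM (neg P)) i j           ≈⟨ *-congˡ (mul-distribˡ-add X idM (neg P) i j) ⟩
      winv * (mul X idM i j + mul X (neg P) i j)   ≈⟨ *-congˡ (+-cong (mul-identityʳ X i j) (trans (mul-negʳ X P i j) (-‿cong (mul-Pʳ X i j)))) ⟩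
      winv * (X i j - X i (prv j))                 ∎

    L-kernel-constant : ∀ {q} (X : Mat n q) → mul L X ≋ zeroM → ∀ i j → X i j ≈ X fz j
    L-kernel-constant X LX≋0 i j = trans (reflexive (≡.cong (λ v → X v j) (≡.sym (ix-toℕ i)))) (along (toℕ i))
      where
      step : ∀ v → X v j ≈ X (nxt v) j
      step v = x∙y⁻¹≈ε⇒x≈y _ _ (winv*x≈0⇒x≈0 (trans (sym (mul-Lˡ X v j)) (LX≋0 v j)))
      along : ∀ m → X (ix m) j ≈ X fz j
      along zero    = refl
      along (suc m) = trans (reflexive (≡.cong (λ v → X v j) (≡.sym (ix-suc m)))) (trans (sym (step (ix m))) (along m))

    αᵀj≋1 : mul (transpose α) ones ≋ scalarM 1#
    αᵀj≋1 _ _ = trans (sum-cong-≋ (λ r → *-identityʳ (winv * w (prv r)))) (Σ[winv*f]≈1 (λ r → w (prv r)) Σ-w∘prv)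

    Lj≋0 : mul L ones ≋ zeroM
    Lj≋0 i j = trans (mul-Lˡ ones i j) (trans (*-congˡ (-‿inverseʳ 1#)) (zeroʳ winv))

    LW+I≋βjᵀ : add (mul L W) idM ≋ mul β (transpose ones)
    LW+I≋βjᵀ i j = begin
      mul L W i j + idM i j                   ≈⟨ +-congʳ (mul-Lˡ W i j) ⟩
      winv * (W i j - W (nxt i) j) + idM i j  ≈⟨ winv[x-y]+d≈winv*z (trans (W-row i j) (+-comm (w i) _)) ⟩
      winv * w i                              ≈⟨ sym (trans (+-identityʳ _) (*-identityʳ _)) ⟩
      winv * w i * 1# + 0#                    ∎

    jᵀβ≋1 : mul (transpose ones) β ≋ scalarM 1#
    jᵀβ≋1 _ _ = trans (sum-cong-≋ (λ r → *-identityˡ (winv * w r))) (Σ[winv*f]≈1 w refl)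

    jᵀL≋0 : mul (transpose ones) L ≋ zeroM
    jᵀL≋0 i j = trans (mul-Lʳ (transpose ones) i j) (trans (*-congˡ (-‿inverseʳ 1#)) (zeroʳ winv))

    WL+I≋jαᵀ : add (mul W L) idM ≋ mul ones (transpose α)
    WL+I≋jαᵀ i j = begin
      mul W L i j + idM i j                   ≈⟨ +-congʳ (mul-Lʳ W i j) ⟩
      winv * (W i j - W i (prv j)) + idM i j  ≈⟨ winv[x-y]+d≈winv*z (W-col i j) ⟩
      winv * w (prv j)                        ≈⟨ sym (trans (+-identityʳ _) (*-identityˡ _)) ⟩
      1# * (winv * w (prv j)) + 0#            ∎

    [Wβ]₀≈λ : mul W β fz fz ≈ λ' * 1#
    [Wβ]₀≈λ = begin
      mul W β fz fz                 ≈⟨ mul-scaleʳ winv W (col w) fz fz ⟩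
      winv * Σ (λ r → W fz r * w r) ≈⟨ *-congˡ Σ-W₀*w≈w2 ⟩
      winv * w2                     ≈⟨ *-comm winv w2 ⟩
      w2 * winv                     ≈⟨ sym (*-identityʳ _) ⟩
      w2 * winv * 1#                ∎

module CycleMatrixIdentities {c ℓ} (R : CommutativeRing c ℓ) (k : ℕ) (w : Fin (suc (suc k)) → CommutativeRing.Carrier R)
         (winv : CommutativeRing.Carrier R) (winv*w≈1 : CommutativeRing._≈_ R (CommutativeRing._*_ R winv (Cyc.Cycle.wsum R k w)) (CommutativeRing.1# R)) where
  open CommutativeRing R
  open Cyc R
  open Cycle k w
  open WithInverse winv
  open MatrixProperties R
  open WeightedCycle R k w
  open Normalised winv winv*w≈1 public
  open import Algebra.Properties.Ring ring using (+-identityˡ-unique)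

  L[Wβ]≋0 : mul L (mul W β) ≋ zeroM
  L[Wβ]≋0 i j = +-identityˡ-unique _ _ (LWβ+β≋β i j)
    where
    open import Relation.Binary.Reasoning.Setoid (≋-setoid n 1)
    LWβ+β≋β : add (mul L (mul W β)) β ≋ β
    LWβ+β≋β = begin
      add (mul L (mul W β)) β                      ≈⟨ add-cong (≋-sym (mul-assoc L W β)) (≋-sym (mul-identityˡ β)) ⟩
      add (mul (mul L W) β) (mul idM β)            ≈⟨ ≋-sym (mul-distribʳ-add (mul L W) idM β) ⟩
      mul (add (mul L W) idM) β                    ≈⟨ mul-congˡ β LW+I≋βjᵀ ⟩
      mul (mul β (transpose ones)) β               ≈⟨ mul-assoc β (transpose ones) β ⟩
      mul β (mul (transpose ones) β)               ≈⟨ mul-congʳ β jᵀβ≋1 ⟩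
      mul β (scalarM 1#)                           ≈⟨ mul-congʳ β scalarM-1#≋idM ⟩
      mul β idM                                    ≈⟨ mul-identityʳ β ⟩
      β                                            ∎

  Wβ≋λj : mul W β ≋ scale λ' ones
  Wβ≋λj i fz = trans (L-kernel-constant (mul W β) L[Wβ]≋0 i fz) [Wβ]₀≈λ

  αᵀW≋λjᵀ : mul (transpose α) W ≋ scale λ' (transpose ones)
  αᵀW≋λjᵀ = ones-mul-injective jαᵀW≋jλjᵀ
    where
    open import Relation.Binary.Reasoning.Setoid (≋-setoid n n)
    jαᵀW≋jλjᵀ : mul ones (mul (transpose α) W) ≋ mul ones (scale λ' (transpose ones))
    jαᵀW≋jλjᵀ = begin
      mul ones (mul (transpose α) W)              ≈⟨ ≋-sym (mul-assoc ones (transpose α) W) ⟩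
      mul (mul ones (transpose α)) W              ≈⟨ mul-congˡ W (≋-sym WL+I≋jαᵀ) ⟩
      mul (add (mul W L) idM) W                   ≈⟨ mul-distribʳ-add (mul W L) idM W ⟩
      add (mul (mul W L) W) (mul idM W)           ≈⟨ add-cong (mul-assoc W L W) (≋-trans (mul-identityˡ W) (≋-sym (mul-identityʳ W))) ⟩
      add (mul W (mul L W)) (mul W idM)           ≈⟨ ≋-sym (mul-distribˡ-add W (mul L W) idM) ⟩
      mul W (add (mul L W) idM)                   ≈⟨ mul-congʳ W LW+I≋βjᵀ ⟩
      mul W (mul β (transpose ones))              ≈⟨ ≋-sym (mul-assoc W β (transpose ones)) ⟩
      mul (mul W β) (transpose ones)              ≈⟨ mul-congˡ (transpose ones) Wβ≋λj ⟩
      mul (scale λ' ones) (transpose ones)        ≈⟨ mul-scaleˡ λ' ones (transpose ones) ⟩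
      scale λ' (mul ones (transpose ones))        ≈⟨ ≋-sym (mul-scaleʳ λ' ones (transpose ones)) ⟩
      mul ones (scale λ' (transpose ones))        ∎

lemma4p1 : ∀ {c ℓ} (R : CommutativeRing c ℓ) (k : ℕ)
             (w : Fin (suc (suc k)) → CommutativeRing.Carrier R)
             (winv : CommutativeRing.Carrier R) →
             let open CommutativeRing R
                 open Cyc R
                 open Cycle k w
                 open WithInverse winv
             in (winv * wsum ≈ 1#) →
                ((mul (transpose α) ones ≋ scalarM 1#)
                 × (mul L ones ≋ zeroM)
                 × (mul (transpose α) W ≋ scale λ' (transpose ones))
                 × (add (mul L W) idM ≋ mul β (transpose ones)))
                × ((mul (transpose ones) β ≋ scalarM 1#)
                 × (mul (transpose ones) L ≋ zeroM)
                 × (mul W β ≋ scale λ' ones)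
                 × (add (mul W L) idM ≋ mul ones (transpose α)))
lemma4p1 R k w winv winv*w≈1 =
  (αᵀj≋1 , Lj≋0 , αᵀW≋λjᵀ , LW+I≋βjᵀ) , (jᵀβ≋1 , jᵀL≋0 , Wβ≋λj , WL+I≋jαᵀ)
  where open CycleMatrixIdentities R k w winv winv*w≈1
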